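{- Consider a single contract with total demand $D>0$ served over $k\ge 1$ optimization cycles of equal length. In every cycle the supply forecast predicts $P>0$ eligible impressions, while the actual number of eligible impressions in every cycle is $A>0$; let $r = 1 - A/P$ be the supply forecast error rate. Set $D_1 = D$, and for $i=1,\dots,k$ let the serving rate chosen at the start of cycle $i$ be $\rho_i = \dfrac{D_i}{(k-i+1)P}$ (the remaining demand divided by the predicted remaining supply), and let $D_{i+1} = D_i - \rho_i A$ (the remaining demand after the $\rho_i A$ impressions actually delivered in cycle $i$). Assume the contract is never infeasible, i.e. $0<\rho_i\le 1$ for all $i=1,\dots,k$. Define the underdelivery as $D_{k+1}/D$ and the overdelivery as $-D_{k+1}/D$. Then: (i) if $r>0$, the underdelivery is positive and at most $\dfrac{r+r^2}{k^{1-r}}$; (ii) if $r<0$, the overdelivery is positive and at most $\dfrac{|r|}{k^{1-r}}$.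
   Context: This models an ad server that periodically re-optimizes a contract's serving rate using a (possibly wrong) supply forecast: at each of the $k$ re-optimization points, the remaining demand is spread uniformly over the forecasted remaining supply, and the contract then receives that rate times the true supply of the cycle.
   Formalization: The total demand $D$, the forecast $P$ and the actual supply $A$ per cycle are rational numbers. -}

module Defs where

open import Data.Nat as ℕ using (ℕ; zero; suc; _∸_)
open import Data.Integer using (+_)
open import Data.Rational using (ℚ; 0ℚ; 1ℚ; _+_; _*_; _-_; _/_; 1/_; _≟_; ≢-nonZero)
open import Relation.Nullary using (yes; no)

ℕ→ℚ : ℕ → ℚ
ℕ→ℚ n = + n / 1

-- total inverse: inv q = 1/q for q ≠ 0 (only ever used at nonzero arguments)
inv : ℚ → ℚ
inv q with q ≟ 0ℚ
... | yes _  = 0ℚ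
... | no q≢0 = 1/_ q {{≢-nonZero q≢0}}

pow : ℚ → ℕ → ℚ
pow q zero    = 1ℚ
pow q (suc n) = q * pow q n

-- Re-optimization process with k cycles, total demand D, forecast P,
-- actual supply A (per cycle).
-- remaining k D P A j  = D_{j+1}   (so remaining … 0 = D_1 = D)
-- rate      k D P A j  = ρ_{j+1} = D_{j+1} / ((k - (j+1) + 1) P) = D_{j+1} / ((k - j) P)
mutual
  remaining : ℕ → ℚ → ℚ → ℚ → ℕ → ℚ
  remaining k D P A zero    = D
  remaining k D P A (suc j) = remaining k D P A j - rate k D P A j * A

  rate : ℕ → ℚ → ℚ → ℚ → ℕ → ℚ
  rate k D P A j = remaining k D P A j * inv (ℕ→ℚ (k ∸ j) * P)

errRate : ℚ → ℚ → ℚ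
errRate P A = 1ℚ - A * inv P

{-# OPTIONS --safe #-}
-- With x = A/P, a cycle with M cycles left multiplies the open demand by (M - x)/M, so
-- D_{k+1}/D = (1 - x) ∏_{M=2}^{k} (1 - x/M), and feasibility makes every factor positive.
-- Writing x = n/d, compare this product with k^(-x) through a potential that cannot grow
-- during a cycle: D_j^d (k + r)^n / (M + r)^n if r > 0, and D_j^d k^n / M^n if r < 0, where
-- M = k - j + 1 is the number of cycles left. That one cycle does not increase it is the
-- weighted AM-GM inequality for the pair (M - x + 1, M - x), resp. (M - x, M), with natural
-- weights; AM-GM in turn follows by induction on the weights from the tangent-line bound for
-- u ↦ u^(m+1). The last cycle then contributes the factor r = 1 - x.
module Submission where

open import Defs
open import Data.Integer as ℤ using (+_)
import Data.Integer.Properties as ℤ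
open import Data.Maybe using (just; nothing)
open import Data.Nat as ℕ using (ℕ; zero; suc; _∸_; z≤n; s≤s)
import Data.Nat.Properties as ℕ
open import Data.Nat.Coprimality using (1-coprimeTo) renaming (sym to coprime-sym)
open import Data.Product using (_×_; _,_; proj₁)
open import Data.Sum using (inj₁; inj₂)
open import Data.Rational
  using ( ℚ; mkℚ; 0ℚ; 1ℚ; _+_; _*_; _-_; -_; ∣_∣; _<_; _≤_; _≟_; *≤*; *<*
        ; ≢-nonZero; nonNegative; nonPositive; positive)
open import Data.Rational.Properties
open import Function using (case_of_)
open import Level using (0ℓ)
open import Relation.Nullary using (yes; no; contradiction)
open import Relation.Binary.PropositionalEquality
open import Tactic.RingSolver using (solve-∀)
import Tactic.RingSolver.Core.AlmostCommutativeRing as ACR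

ring : ACR.AlmostCommutativeRing 0ℓ 0ℓ
ring = ACR.fromCommutativeRing +-*-commutativeRing λ q → case q ≟ 0ℚ of λ
  { (yes q≡0) → just (sym q≡0)
  ; (no _)    → nothing
  }

ℕ→ℚ≡mkℚ : ∀ n → ℕ→ℚ n ≡ mkℚ (+ n) 0 (coprime-sym (1-coprimeTo n))
ℕ→ℚ≡mkℚ n = normalize-coprime (coprime-sym (1-coprimeTo n))

ℕ→ℚ-+ : ∀ m n → ℕ→ℚ (m ℕ.+ n) ≡ ℕ→ℚ m + ℕ→ℚ n
ℕ→ℚ-+ m n rewrite ℕ→ℚ≡mkℚ m | ℕ→ℚ≡mkℚ n
                | ℕ.*-identityʳ m | ℕ.*-identityʳ n | ℤ.+◃n≡+n m | ℤ.+◃n≡+n n = refl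

ℕ→ℚ-suc : ∀ n → ℕ→ℚ (suc n) ≡ 1ℚ + ℕ→ℚ n
ℕ→ℚ-suc = ℕ→ℚ-+ 1

ℕ→ℚ-mono-≤ : ∀ {m n} → m ℕ.≤ n → ℕ→ℚ m ≤ ℕ→ℚ n
ℕ→ℚ-mono-≤ {m} {n} m≤n rewrite ℕ→ℚ≡mkℚ m | ℕ→ℚ≡mkℚ n
  = *≤* (subst₂ ℤ._≤_ (sym (ℤ.*-identityʳ (+ m))) (sym (ℤ.*-identityʳ (+ n))) (ℤ.+≤+ m≤n))

ℕ→ℚ-mono-< : ∀ {m n} → m ℕ.< n → ℕ→ℚ m < ℕ→ℚ n
ℕ→ℚ-mono-< {m} {n} m<n rewrite ℕ→ℚ≡mkℚ m | ℕ→ℚ≡mkℚ n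
  = *<* (subst₂ ℤ._<_ (sym (ℤ.*-identityʳ (+ m))) (sym (ℤ.*-identityʳ (+ n))) (ℤ.+<+ m<n))

ℕ→ℚ-cancel-≤ : ∀ {m n} → ℕ→ℚ m ≤ ℕ→ℚ n → m ℕ.≤ n
ℕ→ℚ-cancel-≤ {m} {n} m≤n rewrite ℕ→ℚ≡mkℚ m | ℕ→ℚ≡mkℚ n with m≤n
... | *≤* le = ℤ.drop‿+≤+ (subst₂ ℤ._≤_ (ℤ.*-identityʳ (+ m)) (ℤ.*-identityʳ (+ n)) le)

ℕ→ℚ-nonNeg : ∀ n → 0ℚ ≤ ℕ→ℚ n
ℕ→ℚ-nonNeg n = ℕ→ℚ-mono-≤ {0} {n} z≤n

ℕ→ℚ-pos : ∀ {n} → 0 ℕ.< n → 0ℚ < ℕ→ℚ n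
ℕ→ℚ-pos = ℕ→ℚ-mono-<

*-monoˡ-≤-nonNeg′ : ∀ {r p q} → 0ℚ ≤ r → p ≤ q → r * p ≤ r * q
*-monoˡ-≤-nonNeg′ {r} 0≤r = *-monoˡ-≤-nonNeg r {{nonNegative 0≤r}}

*-cancelˡ-≤-pos′ : ∀ {r p q} → 0ℚ < r → r * p ≤ r * q → p ≤ q
*-cancelˡ-≤-pos′ {r} 0<r = *-cancelˡ-≤-pos r {{positive 0<r}}

*-mono-≤-nonNeg : ∀ {p q r s} → 0ℚ ≤ p → 0ℚ ≤ r → p ≤ q → r ≤ s → p * r ≤ q * s
*-mono-≤-nonNeg {r = r} 0≤p 0≤r p≤q r≤s =
  ≤-trans (*-monoʳ-≤-nonNeg r {{nonNegative 0≤r}} p≤q) (*-monoˡ-≤-nonNeg′ (≤-trans 0≤p p≤q) r≤s)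

*-nonNeg : ∀ {p q} → 0ℚ ≤ p → 0ℚ ≤ q → 0ℚ ≤ p * q
*-nonNeg {p} {q} 0≤p 0≤q =
  nonNegative⁻¹ _ {{nonNeg*nonNeg⇒nonNeg p {{nonNegative 0≤p}} q {{nonNegative 0≤q}}}}

*-pos : ∀ {p q} → 0ℚ < p → 0ℚ < q → 0ℚ < p * q
*-pos {p} {q} 0<p 0<q = positive⁻¹ _ {{pos*pos⇒pos p {{positive 0<p}} q {{positive 0<q}}}}

pos-*-cancelˡ : ∀ {p q} → 0ℚ < p → 0ℚ < p * q → 0ℚ < q
pos-*-cancelˡ {p} {q} 0<p 0<pq =
  *-cancelˡ-<-nonNeg p {{nonNegative (<⇒≤ 0<p)}} (subst (_< p * q) (sym (*-zeroʳ p)) 0<pq)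

pos-*-cancelʳ : ∀ {p q} → 0ℚ < q → 0ℚ < p * q → 0ℚ < p
pos-*-cancelʳ {p} {q} 0<q 0<pq = pos-*-cancelˡ 0<q (subst (0ℚ <_) (*-comm p q) 0<pq)

p≤q+p : ∀ {p q} → 0ℚ ≤ q → p ≤ q + p
p≤q+p {p} {q} 0≤q = subst (_≤ q + p) (+-identityˡ p) (+-monoˡ-≤ p 0≤q)

p≤p+q : ∀ {p q} → 0ℚ ≤ q → p ≤ p + q
p≤p+q {p} {q} 0≤q = subst (_≤ p + q) (+-identityʳ p) (+-monoʳ-≤ p 0≤q)

0<q-p⇒p<q : ∀ {p q} → 0ℚ < q - p → p < q
0<q-p⇒p<q {p} {q} 0<q-p = subst₂ _<_ (+-identityˡ p) (cancel q p) (+-monoˡ-< p 0<q-p)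
  where
  cancel : ∀ q p → q - p + p ≡ q
  cancel = solve-∀ ring

q-p<0⇒q<p : ∀ {p q} → q - p < 0ℚ → q < p
q-p<0⇒q<p {p} {q} q-p<0 = subst₂ _<_ (cancel q p) (+-identityˡ p) (+-monoˡ-< p q-p<0)
  where
  cancel : ∀ q p → q - p + p ≡ q
  cancel = solve-∀ ring

*-inv : ∀ {q} → 0ℚ < q → q * inv q ≡ 1ℚ
*-inv {q} 0<q with q ≟ 0ℚ
... | yes q≡0 = contradiction (sym q≡0) (<⇒≢ 0<q)
... | no q≢0  = *-inverseʳ q {{≢-nonZero q≢0}}

inv-pos : ∀ {q} → 0ℚ < q → 0ℚ < inv q
inv-pos 0<q = pos-*-cancelˡ 0<q (subst (0ℚ <_) (sym (*-inv 0<q)) (positive⁻¹ 1ℚ))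

inv-*-cancelˡ : ∀ {m p} → 0ℚ < m → 0ℚ < p → inv (m * p) * m ≡ inv p
inv-*-cancelˡ {m} {p} 0<m 0<p = begin
  inv (m * p) * m                   ≡⟨ sym (*-identityʳ _) ⟩
  inv (m * p) * m * 1ℚ              ≡⟨ cong (inv (m * p) * m *_) (sym (*-inv 0<p)) ⟩
  inv (m * p) * m * (p * inv p)     ≡⟨ regroup (inv (m * p)) m p (inv p) ⟩
  m * p * inv (m * p) * inv p       ≡⟨ cong (_* inv p) (*-inv (*-pos 0<m 0<p)) ⟩
  1ℚ * inv p                        ≡⟨ *-identityˡ _ ⟩
  inv p                             ∎
  where
  open ≡-Reasoning
  regroup : ∀ a m p b → a * m * (p * b) ≡ m * p * a * b
  regroup = solve-∀ ring

pow-distrib-* : ∀ p q n → pow (p * q) n ≡ pow p n * pow q n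
pow-distrib-* p q zero    = refl
pow-distrib-* p q (suc n) = begin
  p * q * pow (p * q) n         ≡⟨ cong (p * q *_) (pow-distrib-* p q n) ⟩
  p * q * (pow p n * pow q n)   ≡⟨ interchange p q (pow p n) (pow q n) ⟩
  p * pow p n * (q * pow q n)   ∎
  where
  open ≡-Reasoning
  interchange : ∀ a b c d → a * b * (c * d) ≡ a * c * (b * d)
  interchange = solve-∀ ring

pow-+ : ∀ p m n → pow p (m ℕ.+ n) ≡ pow p m * pow p n
pow-+ p zero    n = sym (*-identityˡ (pow p n))
pow-+ p (suc m) n = trans (cong (p *_) (pow-+ p m n)) (sym (*-assoc p (pow p m) (pow p n)))

pow-1ℚ : ∀ n → pow 1ℚ n ≡ 1ℚ
pow-1ℚ zero    = refl
pow-1ℚ (suc n) = trans (*-identityˡ (pow 1ℚ n)) (pow-1ℚ n)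

pow-nonNeg : ∀ {p} n → 0ℚ ≤ p → 0ℚ ≤ pow p n
pow-nonNeg zero    _   = <⇒≤ (positive⁻¹ 1ℚ)
pow-nonNeg (suc n) 0≤p = *-nonNeg 0≤p (pow-nonNeg n 0≤p)

pow-pos : ∀ {p} n → 0ℚ < p → 0ℚ < pow p n
pow-pos zero    _   = positive⁻¹ 1ℚ
pow-pos (suc n) 0<p = *-pos 0<p (pow-pos n 0<p)

pow-monoˡ-≤ : ∀ {p q} n → 0ℚ ≤ p → p ≤ q → pow p n ≤ pow q n
pow-monoˡ-≤ zero    _   _   = ≤-refl
pow-monoˡ-≤ (suc n) 0≤p p≤q = *-mono-≤-nonNeg 0≤p (pow-nonNeg n 0≤p) p≤q (pow-monoˡ-≤ n 0≤p p≤q)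

pow-monoʳ-≤ : ∀ {p m n} → 1ℚ ≤ p → m ℕ.≤ n → pow p m ≤ pow p n
pow-monoʳ-≤ {p} {m} 1≤p m≤n with ℕ.m≤n⇒∃[o]m+o≡n m≤n
... | e , refl = begin
  pow p m             ≡⟨ sym (*-identityʳ (pow p m)) ⟩
  pow p m * 1ℚ        ≤⟨ *-monoˡ-≤-nonNeg′ (pow-nonNeg m 0≤p) 1≤pow ⟩
  pow p m * pow p e   ≡⟨ sym (pow-+ p m e) ⟩
  pow p (m ℕ.+ e)     ∎
  where
  open ≤-Reasoning
  0≤p = ≤-trans (<⇒≤ (positive⁻¹ 1ℚ)) 1≤p
  1≤pow : 1ℚ ≤ pow p e
  1≤pow = subst (_≤ pow p e) (pow-1ℚ e) (pow-monoˡ-≤ e (<⇒≤ (positive⁻¹ 1ℚ)) 1≤p)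

pow-self-pos : ∀ n → 0ℚ < pow (ℕ→ℚ n) n
pow-self-pos zero    = positive⁻¹ 1ℚ
pow-self-pos (suc n) = pow-pos (suc n) (ℕ→ℚ-pos {suc n} (s≤s z≤n))

square-nonNeg : ∀ p → 0ℚ ≤ p * p
square-nonNeg p with ≤-total 0ℚ p
... | inj₁ 0≤p = *-nonNeg 0≤p 0≤p
... | inj₂ p≤0 = nonNegative⁻¹ _ {{nonPos*nonPos⇒nonPos p {{nonPositive p≤0}} p {{nonPositive p≤0}}}}

-- The left-hand side is v^(m+1) + (m+1) v^m (u - v), the tangent line of u ↦ u^(m+1) at v.
pow-≥-tangent : ∀ m {u v} → 0ℚ ≤ u → 0ℚ ≤ v →
                pow v m * ((1ℚ + ℕ→ℚ m) * u - ℕ→ℚ m * v) ≤ pow u (suc m)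
pow-≥-tangent zero {u} {v} _ _ = ≤-reflexive (base u v)
  where
  base : ∀ u v → 1ℚ * ((1ℚ + 0ℚ) * u - 0ℚ * v) ≡ u * 1ℚ
  base = solve-∀ ring
pow-≥-tangent (suc m) {u} {v} 0≤u 0≤v rewrite ℕ→ℚ-suc m = begin
  v * W * ((1ℚ + (1ℚ + M)) * u - (1ℚ + M) * v)
    ≤⟨ p≤q+p (*-nonNeg (*-nonNeg (pow-nonNeg m 0≤v) (1+M-nonNeg)) (square-nonNeg (u - v))) ⟩
  W * (1ℚ + M) * ((u - v) * (u - v)) + v * W * ((1ℚ + (1ℚ + M)) * u - (1ℚ + M) * v)
    ≡⟨ complete-square v W M u ⟩
  u * (W * ((1ℚ + M) * u - M * v))
    ≤⟨ *-monoˡ-≤-nonNeg′ 0≤u (pow-≥-tangent m 0≤u 0≤v) ⟩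
  u * pow u (suc m) ∎
  where
  open ≤-Reasoning
  W = pow v m
  M = ℕ→ℚ m
  1+M-nonNeg : 0ℚ ≤ 1ℚ + M
  1+M-nonNeg = subst (0ℚ ≤_) (ℕ→ℚ-suc m) (ℕ→ℚ-nonNeg (suc m))
  complete-square : ∀ v W M u →
    W * (1ℚ + M) * ((u - v) * (u - v)) + v * W * ((1ℚ + (1ℚ + M)) * u - (1ℚ + M) * v)
      ≡ u * (W * ((1ℚ + M) * u - M * v))
  complete-square = solve-∀ ring

-- AM-GM for N copies of S/N and one copy of b: the tangent bound at u = N (S + b),
-- v = (N + 1) S, divided by N.
am-gm-step : ∀ N {S b} → 0ℚ ≤ S → 0ℚ ≤ b →
             pow (ℕ→ℚ (suc N)) (suc N) * (pow S N * b) ≤ pow (ℕ→ℚ N) N * pow (S + b) (suc N)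
am-gm-step zero {S} {b} 0≤S _ = subst₂ _≤_ (sym (lhs b)) (sym (rhs S b)) (p≤q+p 0≤S)
  where
  lhs : ∀ b → 1ℚ * 1ℚ * (1ℚ * b) ≡ b
  lhs = solve-∀ ring
  rhs : ∀ S b → 1ℚ * ((S + b) * 1ℚ) ≡ S + b
  rhs = solve-∀ ring
am-gm-step (suc N) {S} {b} 0≤S 0≤b rewrite ℕ→ℚ-suc (suc N) = *-cancelˡ-≤-pos′ 0<N₁ (begin
  N₁ * ((1ℚ + N₁) * pow (1ℚ + N₁) (suc N) * (pow S (suc N) * b))
    ≡⟨ regroup N₁ (pow (1ℚ + N₁) (suc N)) (pow S (suc N)) b S ⟩
  pow (1ℚ + N₁) (suc N) * pow S (suc N) * T
    ≡⟨ cong (_* T) (sym (pow-distrib-* (1ℚ + N₁) S (suc N))) ⟩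
  pow ((1ℚ + N₁) * S) (suc N) * T
    ≤⟨ pow-≥-tangent (suc N) (*-nonNeg 0≤N₁ 0≤S+b) (*-nonNeg 0≤1+N₁ 0≤S) ⟩
  pow (N₁ * (S + b)) (suc (suc N))
    ≡⟨ pow-distrib-* N₁ (S + b) (suc (suc N)) ⟩
  N₁ * pow N₁ (suc N) * pow (S + b) (suc (suc N))
    ≡⟨ *-assoc N₁ (pow N₁ (suc N)) (pow (S + b) (suc (suc N))) ⟩
  N₁ * (pow N₁ (suc N) * pow (S + b) (suc (suc N))) ∎)
  where
  open ≤-Reasoning
  N₁ = ℕ→ℚ (suc N)
  T = (1ℚ + N₁) * (N₁ * (S + b)) - N₁ * ((1ℚ + N₁) * S)
  0<N₁ = ℕ→ℚ-pos {suc N} (s≤s z≤n)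
  0≤N₁ = <⇒≤ 0<N₁
  0≤1+N₁ = ≤-trans 0≤N₁ (p≤q+p (<⇒≤ (positive⁻¹ 1ℚ)))
  0≤S+b = ≤-trans 0≤S (p≤p+q 0≤b)
  regroup : ∀ n a s b S →
    n * ((1ℚ + n) * a * (s * b)) ≡ a * s * ((1ℚ + n) * (n * (S + b)) - n * ((1ℚ + n) * S))
  regroup = solve-∀ ring

am-gm-scaled : ∀ p e {b c} → 0ℚ ≤ b → 0ℚ ≤ c →
               pow (ℕ→ℚ (p ℕ.+ e)) (p ℕ.+ e) * (pow b p * pow c e)
                 ≤ pow (ℕ→ℚ p * b + ℕ→ℚ e * c) (p ℕ.+ e)
am-gm-scaled zero e {b} {c} _ _ = ≤-reflexive (begin
  pow E e * (1ℚ * pow c e)     ≡⟨ cong (pow E e *_) (*-identityˡ (pow c e)) ⟩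
  pow E e * pow c e            ≡⟨ sym (pow-distrib-* E c e) ⟩
  pow (E * c) e                ≡⟨ cong (λ t → pow t e) (sym (drop-zero b (E * c))) ⟩
  pow (0ℚ * b + E * c) e       ∎)
  where
  open ≡-Reasoning
  E = ℕ→ℚ e
  drop-zero : ∀ b q → 0ℚ * b + q ≡ q
  drop-zero = solve-∀ ring
am-gm-scaled (suc p) e {b} {c} 0≤b 0≤c = begin
  pow N₁ (suc N) * (b * pow b p * pow c e)    ≤⟨ *-cancelˡ-≤-pos′ (pow-self-pos N) step ⟩
  pow (S + b) (suc N)                         ≡⟨ cong (λ t → pow t (suc N)) (sym mean-suc) ⟩
  pow (ℕ→ℚ (suc p) * b + ℕ→ℚ e * c) (suc N)  ∎
  where
  open ≤-Reasoning
  N = p ℕ.+ e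
  Nℚ = ℕ→ℚ N
  N₁ = ℕ→ℚ (suc N)
  S = ℕ→ℚ p * b + ℕ→ℚ e * c
  0≤S = ≤-trans (*-nonNeg (ℕ→ℚ-nonNeg p) 0≤b) (p≤p+q (*-nonNeg (ℕ→ℚ-nonNeg e) 0≤c))
  0≤N₁b = *-nonNeg (pow-nonNeg (suc N) (ℕ→ℚ-nonNeg (suc N))) 0≤b
  regroup : ∀ a n b x y → a * (n * (b * x * y)) ≡ n * b * (a * (x * y))
  regroup = solve-∀ ring
  swap : ∀ n b s → n * b * s ≡ n * (s * b)
  swap = solve-∀ ring
  shift : ∀ P b E c → (1ℚ + P) * b + E * c ≡ P * b + E * c + b
  shift = solve-∀ ring
  mean-suc : ℕ→ℚ (suc p) * b + ℕ→ℚ e * c ≡ S + b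
  mean-suc = trans (cong (λ t → t * b + ℕ→ℚ e * c) (ℕ→ℚ-suc p)) (shift (ℕ→ℚ p) b (ℕ→ℚ e) c)
  step : pow Nℚ N * (pow N₁ (suc N) * (b * pow b p * pow c e)) ≤ pow Nℚ N * pow (S + b) (suc N)
  step = begin
    pow Nℚ N * (pow N₁ (suc N) * (b * pow b p * pow c e))
      ≡⟨ regroup (pow Nℚ N) (pow N₁ (suc N)) b (pow b p) (pow c e) ⟩
    pow N₁ (suc N) * b * (pow Nℚ N * (pow b p * pow c e))
      ≤⟨ *-monoˡ-≤-nonNeg′ 0≤N₁b (am-gm-scaled p e 0≤b 0≤c) ⟩
    pow N₁ (suc N) * b * pow S N                           ≡⟨ swap (pow N₁ (suc N)) b (pow S N) ⟩
    pow N₁ (suc N) * (pow S N * b)                         ≤⟨ am-gm-step N 0≤S 0≤b ⟩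
    pow Nℚ N * pow (S + b) (suc N)                         ∎

am-gm : ∀ p e {b c m} → 0ℚ ≤ b → 0ℚ ≤ c →
        ℕ→ℚ (p ℕ.+ e) * m ≡ ℕ→ℚ p * b + ℕ→ℚ e * c → pow b p * pow c e ≤ pow m (p ℕ.+ e)
am-gm p e {b} {c} {m} 0≤b 0≤c mean = *-cancelˡ-≤-pos′ (pow-self-pos (p ℕ.+ e)) (begin
  pow N (p ℕ.+ e) * (pow b p * pow c e)  ≤⟨ am-gm-scaled p e 0≤b 0≤c ⟩
  pow (ℕ→ℚ p * b + ℕ→ℚ e * c) (p ℕ.+ e) ≡⟨ cong (λ t → pow t (p ℕ.+ e)) (sym mean) ⟩
  pow (N * m) (p ℕ.+ e)                  ≡⟨ pow-distrib-* N m (p ℕ.+ e) ⟩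
  pow N (p ℕ.+ e) * pow m (p ℕ.+ e)      ∎)
  where
  open ≤-Reasoning
  N = ℕ→ℚ (p ℕ.+ e)

-- The potential steps for g M = M + (1 - x) with x = n/(n+e), and for g M = M with x = (d+e)/d.
cycle-under : ∀ n e {x M} → 0ℚ ≤ M - x → x * ℕ→ℚ (n ℕ.+ e) ≡ ℕ→ℚ n →
              pow (M - x) (n ℕ.+ e) * pow (M - x + 1ℚ) n ≤ pow M (n ℕ.+ e) * pow (M - x) n
cycle-under n e {x} {M} 0≤y x[n+e]≡n = begin
  pow y (n ℕ.+ e) * pow (y + 1ℚ) n    ≡⟨ cong (_* pow (y + 1ℚ) n) (pow-+ y n e) ⟩
  pow y n * pow y e * pow (y + 1ℚ) n  ≡⟨ rotate (pow y n) (pow y e) (pow (y + 1ℚ) n) ⟩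
  pow y n * (pow (y + 1ℚ) n * pow y e) ≤⟨ *-monoˡ-≤-nonNeg′ (pow-nonNeg n 0≤y) (am-gm n e 0≤y+1 0≤y mean) ⟩
  pow y n * pow M (n ℕ.+ e)           ≡⟨ *-comm (pow y n) (pow M (n ℕ.+ e)) ⟩
  pow M (n ℕ.+ e) * pow y n           ∎
  where
  open ≤-Reasoning
  y = M - x
  N = ℕ→ℚ n
  E = ℕ→ℚ e
  0≤y+1 = ≤-trans 0≤y (p≤p+q (<⇒≤ (positive⁻¹ 1ℚ)))
  rotate : ∀ a b c → a * b * c ≡ a * (c * b)
  rotate = solve-∀ ring
  split : ∀ N E M x → (N + E) * M ≡ (N + E) * (M - x) + x * (N + E)
  split = solve-∀ ring
  regroup : ∀ N E y → (N + E) * y + N ≡ N * (y + 1ℚ) + E * y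
  regroup = solve-∀ ring
  x[N+E]≡N : x * (N + E) ≡ N
  x[N+E]≡N = trans (cong (x *_) (sym (ℕ→ℚ-+ n e))) x[n+e]≡n
  mean : ℕ→ℚ (n ℕ.+ e) * M ≡ N * (y + 1ℚ) + E * y
  mean = ≡.begin
    ℕ→ℚ (n ℕ.+ e) * M         ≡.≡⟨ cong (_* M) (ℕ→ℚ-+ n e) ⟩
    (N + E) * M               ≡.≡⟨ split N E M x ⟩
    (N + E) * y + x * (N + E) ≡.≡⟨ cong (λ t → (N + E) * y + t) x[N+E]≡N ⟩
    (N + E) * y + N           ≡.≡⟨ regroup N E y ⟩
    N * (y + 1ℚ) + E * y      ≡.∎
    where module ≡ = ≡-Reasoning

cycle-over : ∀ d e {x M} → 0ℚ ≤ M - x → 0ℚ ≤ M → x * ℕ→ℚ d ≡ ℕ→ℚ (d ℕ.+ e) →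
             pow (M - x) d * pow M (d ℕ.+ e) ≤ pow M d * pow (M - 1ℚ) (d ℕ.+ e)
cycle-over d e {x} {M} 0≤y 0≤M xd≡d+e = begin
  pow y d * pow M (d ℕ.+ e)        ≡⟨ cong (pow y d *_) (pow-+ M d e) ⟩
  pow y d * (pow M d * pow M e)    ≡⟨ rotate (pow y d) (pow M d) (pow M e) ⟩
  pow M d * (pow y d * pow M e)    ≤⟨ *-monoˡ-≤-nonNeg′ (pow-nonNeg d 0≤M) (am-gm d e 0≤y 0≤M mean) ⟩
  pow M d * pow (M - 1ℚ) (d ℕ.+ e) ∎
  where
  open ≤-Reasoning
  y = M - x
  Dq = ℕ→ℚ d
  E = ℕ→ℚ e
  rotate : ∀ a b c → a * (b * c) ≡ b * (a * c)
  rotate = solve-∀ ring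
  expand : ∀ n M → n * (M - 1ℚ) ≡ n * M - n
  expand = solve-∀ ring
  regroup : ∀ D E M x → (D + E) * M - x * D ≡ D * (M - x) + E * M
  regroup = solve-∀ ring
  mean : ℕ→ℚ (d ℕ.+ e) * (M - 1ℚ) ≡ Dq * y + E * M
  mean = ≡.begin
    ℕ→ℚ (d ℕ.+ e) * (M - 1ℚ)            ≡.≡⟨ expand (ℕ→ℚ (d ℕ.+ e)) M ⟩
    ℕ→ℚ (d ℕ.+ e) * M - ℕ→ℚ (d ℕ.+ e)  ≡.≡⟨ cong₂ (λ s t → s * M - t) (ℕ→ℚ-+ d e) (sym xd≡d+e) ⟩
    (Dq + E) * M - x * Dq               ≡.≡⟨ regroup Dq E M x ⟩
    Dq * y + E * M                      ≡.∎
    where module ≡ = ≡-Reasoning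

pow-*-inv-≤ : ∀ {a b c D} d → 0ℚ < D → pow a d * c ≤ pow D d * b → pow (a * inv D) d * c ≤ b
pow-*-inv-≤ {a} {b} {c} {D} d 0<D a^dc≤D^db = begin
  pow (a * inv D) d * c          ≡⟨ cong (_* c) (pow-distrib-* a (inv D) d) ⟩
  pow a d * pow (inv D) d * c    ≡⟨ rotate (pow a d) (pow (inv D) d) c ⟩
  pow (inv D) d * (pow a d * c)  ≤⟨ *-monoˡ-≤-nonNeg′ (pow-nonNeg d (<⇒≤ (inv-pos 0<D))) a^dc≤D^db ⟩
  pow (inv D) d * (pow D d * b)  ≡⟨ sym (*-assoc (pow (inv D) d) (pow D d) b) ⟩
  pow (inv D) d * pow D d * b    ≡⟨ cong (_* b) (sym (pow-distrib-* (inv D) D d)) ⟩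
  pow (inv D * D) d * b          ≡⟨ cong (λ t → pow t d * b) (trans (*-comm (inv D) D) (*-inv 0<D)) ⟩
  pow 1ℚ d * b                   ≡⟨ cong (_* b) (pow-1ℚ d) ⟩
  1ℚ * b                         ≡⟨ *-identityˡ b ⟩
  b                              ∎
  where
  open ≤-Reasoning
  rotate : ∀ a i c → a * i * c ≡ i * (a * c)
  rotate = solve-∀ ring

pow-*-≤ : ∀ {a s c b} d → 0ℚ ≤ s → pow a d * c ≤ b → pow (a * s) d * c ≤ pow s d * b
pow-*-≤ {a} {s} {c} {b} d 0≤s a^dc≤b = begin
  pow (a * s) d * c           ≡⟨ cong (_* c) (pow-distrib-* a s d) ⟩
  pow a d * pow s d * c       ≡⟨ rotate (pow a d) (pow s d) c ⟩
  pow s d * (pow a d * c)     ≤⟨ *-monoˡ-≤-nonNeg′ (pow-nonNeg d 0≤s) a^dc≤b ⟩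
  pow s d * b                 ∎
  where
  open ≤-Reasoning
  rotate : ∀ a s c → a * s * c ≡ s * (a * c)
  rotate = solve-∀ ring

∸-suc : ∀ {m n} → n ℕ.< m → m ∸ n ≡ suc (m ∸ suc n)
∸-suc {suc m} {zero}  _         = refl
∸-suc {suc m} {suc n} (s≤s n<m) = ∸-suc n<m

ℕ→ℚ-∸-suc : ∀ {m n} → n ℕ.< m → ℕ→ℚ (m ∸ suc n) ≡ ℕ→ℚ (m ∸ n) - 1ℚ
ℕ→ℚ-∸-suc {m} {n} n<m = begin
  ℕ→ℚ (m ∸ suc n)              ≡⟨ sym (cancel (ℕ→ℚ (m ∸ suc n))) ⟩
  1ℚ + ℕ→ℚ (m ∸ suc n) - 1ℚ   ≡⟨ cong (_- 1ℚ) (sym (ℕ→ℚ-suc (m ∸ suc n))) ⟩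
  ℕ→ℚ (suc (m ∸ suc n)) - 1ℚ  ≡⟨ cong (λ t → ℕ→ℚ t - 1ℚ) (sym (∸-suc n<m)) ⟩
  ℕ→ℚ (m ∸ n) - 1ℚ            ∎
  where
  open ≡-Reasoning
  cancel : ∀ q → 1ℚ + q - 1ℚ ≡ q
  cancel = solve-∀ ring

ℕ→ℚ-∸-pos : ∀ {m n} → n ℕ.< m → 0ℚ < ℕ→ℚ (m ∸ n)
ℕ→ℚ-∸-pos n<m = ℕ→ℚ-pos (ℕ.m<n⇒0<n∸m n<m)

ratio≤1⇒≤ : ∀ {x} n d → x ≤ 1ℚ → x * ℕ→ℚ d ≡ ℕ→ℚ n → n ℕ.≤ d
ratio≤1⇒≤ {x} n d x≤1 xd≡n = ℕ→ℚ-cancel-≤ {n} {d}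
  (subst₂ _≤_ xd≡n (*-identityˡ (ℕ→ℚ d)) (*-monoʳ-≤-nonNeg (ℕ→ℚ d) {{d≥0}} x≤1))
  where d≥0 = nonNegative (ℕ→ℚ-nonNeg d)

ratio≥1⇒≥ : ∀ {x} n d → 1ℚ ≤ x → x * ℕ→ℚ d ≡ ℕ→ℚ n → d ℕ.≤ n
ratio≥1⇒≥ {x} n d 1≤x xd≡n = ℕ→ℚ-cancel-≤ {d} {n}
  (subst₂ _≤_ (*-identityˡ (ℕ→ℚ d)) xd≡n (*-monoʳ-≤-nonNeg (ℕ→ℚ d) {{d≥0}} 1≤x))
  where d≥0 = nonNegative (ℕ→ℚ-nonNeg d)

module Reoptimisation (k : ℕ) (D P A : ℚ) (0<P : 0ℚ < P) where

  A/P : ℚ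
  A/P = A * inv P

  R : ℕ → ℚ
  R = remaining k D P A

  remaining-step : ∀ {j} → j ℕ.< k → R (suc j) * ℕ→ℚ (k ∸ j) ≡ R j * (ℕ→ℚ (k ∸ j) - A/P)
  remaining-step {j} j<k = begin
    (R j - R j * inv (M * P) * A) * M     ≡⟨ distribute (R j) (inv (M * P)) A M ⟩
    R j * M - R j * (inv (M * P) * M) * A
      ≡⟨ cong (λ t → R j * M - R j * t * A) (inv-*-cancelˡ (ℕ→ℚ-∸-pos j<k) 0<P) ⟩
    R j * M - R j * inv P * A             ≡⟨ factor (R j) M (inv P) A ⟩
    R j * (M - A/P)                       ∎
    where
    open ≡-Reasoning
    M = ℕ→ℚ (k ∸ j)
    distribute : ∀ r i a m → (r - r * i * a) * m ≡ r * m - r * (i * m) * a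
    distribute = solve-∀ ring
    factor : ∀ r m i a → r * m - r * i * a ≡ r * (m - a * i)
    factor = solve-∀ ring

  A/P-from-weights : ∀ n d → A * ℕ→ℚ d ≡ P * ℕ→ℚ n → A/P * ℕ→ℚ d ≡ ℕ→ℚ n
  A/P-from-weights n d Ad≡Pn = begin
    A * inv P * ℕ→ℚ d       ≡⟨ swap A (inv P) (ℕ→ℚ d) ⟩
    inv P * (A * ℕ→ℚ d)     ≡⟨ cong (inv P *_) Ad≡Pn ⟩
    inv P * (P * ℕ→ℚ n)     ≡⟨ sym (*-assoc (inv P) P (ℕ→ℚ n)) ⟩
    inv P * P * ℕ→ℚ n       ≡⟨ cong (_* ℕ→ℚ n) (trans (*-comm (inv P) P) (*-inv 0<P)) ⟩
    1ℚ * ℕ→ℚ n              ≡⟨ *-identityˡ (ℕ→ℚ n) ⟩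
    ℕ→ℚ n                   ∎
    where
    open ≡-Reasoning
    swap : ∀ a i d → a * i * d ≡ i * (a * d)
    swap = solve-∀ ring

  -- A cycle with M cycles left does not increase the potential R_j^d / g(M)^n.
  PotentialStep : (ℚ → ℚ) → ℕ → ℕ → Set
  PotentialStep g d n =
    ∀ {M} → 0ℚ < M → 0ℚ ≤ M - A/P → pow (M - A/P) d * pow (g M) n ≤ pow M d * pow (g (M - 1ℚ)) n

  module Feasible (feasible : ∀ j → j ℕ.< k → 0ℚ < rate k D P A j) where

    remaining-pos : ∀ {j} → j ℕ.< k → 0ℚ < R j
    remaining-pos {j} j<k = pos-*-cancelʳ (inv-pos (*-pos (ℕ→ℚ-∸-pos j<k) 0<P)) (feasible j j<k)

    gap-pos : ∀ {j} → suc j ℕ.< k → 0ℚ < ℕ→ℚ (k ∸ j) - A/P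
    gap-pos {j} sj<k = pos-*-cancelˡ (remaining-pos j<k)
      (subst (0ℚ <_) (remaining-step j<k) (*-pos (remaining-pos sj<k) (ℕ→ℚ-∸-pos j<k)))
      where
      j<k = ℕ.<-trans (ℕ.n<1+n j) sj<k

    potential-descent : (g : ℚ → ℚ) (d n : ℕ) → PotentialStep g d n →
      ∀ {j} → j ℕ.< k → pow (R j) d * pow (g (ℕ→ℚ k)) n ≤ pow D d * pow (g (ℕ→ℚ (k ∸ j))) n
    potential-descent g d n cycle {zero}  _    = ≤-refl
    potential-descent g d n cycle {suc j} sj<k = *-cancelˡ-≤-pos′ (pow-pos d 0<M) (begin
      pow M d * (pow (R (suc j)) d * G)         ≡⟨ one-cycle ⟩
      pow (R j * y) d * G                       ≤⟨ pow-*-≤ d 0≤y (potential-descent g d n cycle j<k) ⟩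
      pow y d * (pow D d * pow (g M) n)         ≡⟨ swap (pow y d) (pow D d) (pow (g M) n) ⟩
      pow D d * (pow y d * pow (g M) n)         ≤⟨ *-monoˡ-≤-nonNeg′ (pow-nonNeg d 0≤D) (cycle 0<M 0≤y) ⟩
      pow D d * (pow M d * pow (g (M - 1ℚ)) n)  ≡⟨ swap (pow D d) (pow M d) (pow (g (M - 1ℚ)) n) ⟩
      pow M d * (pow D d * pow (g (M - 1ℚ)) n)
        ≡⟨ cong (λ t → pow M d * (pow D d * pow (g t) n)) (ℕ→ℚ-∸-suc j<k) ⟨
      pow M d * (pow D d * pow (g (ℕ→ℚ (k ∸ suc j))) n) ∎)
      where
      open ≤-Reasoning
      j<k = ℕ.<-trans (ℕ.n<1+n j) sj<k
      M = ℕ→ℚ (k ∸ j)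
      y = M - A/P
      G = pow (g (ℕ→ℚ k)) n
      0<M = ℕ→ℚ-∸-pos j<k
      0≤y = <⇒≤ (gap-pos sj<k)
      0≤D = <⇒≤ (remaining-pos (ℕ.≤-<-trans z≤n j<k))
      swap : ∀ a b c → a * (b * c) ≡ b * (a * c)
      swap = solve-∀ ring
      M*R[j+1]≡R[j]*y : M * R (suc j) ≡ R j * y
      M*R[j+1]≡R[j]*y = trans (*-comm M (R (suc j))) (remaining-step j<k)
      one-cycle : pow M d * (pow (R (suc j)) d * G) ≡ pow (R j * y) d * G
      one-cycle = ≡.begin
        pow M d * (pow (R (suc j)) d * G)  ≡.≡⟨ *-assoc (pow M d) (pow (R (suc j)) d) G ⟨
        pow M d * pow (R (suc j)) d * G    ≡.≡⟨ cong (_* G) (pow-distrib-* M (R (suc j)) d) ⟨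
        pow (M * R (suc j)) d * G          ≡.≡⟨ cong (λ t → pow t d * G) M*R[j+1]≡R[j]*y ⟩
        pow (R j * y) d * G                ≡.∎
        where module ≡ = ≡-Reasoning

module Delivery (k′ : ℕ) (D P A : ℚ) (0<D : 0ℚ < D) (0<P : 0ℚ < P)
                (feasible : ∀ j → j ℕ.< suc k′ → 0ℚ < rate (suc k′) D P A j) where

  open Reoptimisation (suc k′) D P A 0<P
  open Feasible feasible

  r : ℚ
  r = errRate P A

  K : ℚ
  K = ℕ→ℚ (suc k′)

  underdelivery : ℚ
  underdelivery = R (suc k′) * inv D

  overdelivery : ℚ
  overdelivery = - underdelivery

  -- D_k / D in the paper's notation: the share of the demand still open before the last cycle.
  openShare : ℚ
  openShare = R k′ * inv D

  openShare-pos : 0ℚ < openShare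
  openShare-pos = *-pos (remaining-pos (ℕ.n<1+n k′)) (inv-pos 0<D)

  underdelivery≡openShare*r : underdelivery ≡ openShare * r
  underdelivery≡openShare*r = begin
    R (suc k′) * inv D           ≡⟨ cong (_* inv D) (sym (*-identityʳ (R (suc k′)))) ⟩
    R (suc k′) * 1ℚ * inv D      ≡⟨ cong (_* inv D) last-cycle ⟩
    R k′ * r * inv D             ≡⟨ swap (R k′) r (inv D) ⟩
    openShare * r                ∎
    where
    open ≡-Reasoning
    last-cycle : R (suc k′) * 1ℚ ≡ R k′ * r
    last-cycle = subst (λ m → R (suc k′) * ℕ→ℚ m ≡ R k′ * (ℕ→ℚ m - A/P)) (ℕ.m+n∸n≡m 1 k′)
                       (remaining-step (ℕ.n<1+n k′))
    swap : ∀ a r i → a * r * i ≡ a * i * r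
    swap = solve-∀ ring

  overdelivery≡openShare*-r : overdelivery ≡ openShare * - r
  overdelivery≡openShare*-r = trans (cong -_ underdelivery≡openShare*r) (neg-distribʳ-* openShare r)

  descent-to-last : (g : ℚ → ℚ) (d n : ℕ) → PotentialStep g d n →
    pow openShare d * pow (g K) n ≤ pow (g 1ℚ) n
  descent-to-last g d n cycle = pow-*-inv-≤ d 0<D
    (subst (λ m → pow (R k′) d * pow (g K) n ≤ pow D d * pow (g (ℕ→ℚ m)) n) (ℕ.m+n∸n≡m 1 k′)
           (potential-descent g d n cycle (ℕ.n<1+n k′)))

  underdelivery-pow-≤ : 0ℚ ≤ r → ∀ n e {d} → n ℕ.+ e ≡ d → A/P * ℕ→ℚ d ≡ ℕ→ℚ n →
                        pow underdelivery d * pow K n ≤ pow (r + r * r) d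
  underdelivery-pow-≤ 0≤r n e {d} refl weights = begin
    pow underdelivery d * pow K n     ≡⟨ cong (λ t → pow t d * pow K n) underdelivery≡openShare*r ⟩
    pow (openShare * r) d * pow K n   ≤⟨ pow-*-≤ d 0≤r openShare-bound ⟩
    pow r d * pow (1ℚ + r) d          ≡⟨ sym (pow-distrib-* r (1ℚ + r) d) ⟩
    pow (r * (1ℚ + r)) d              ≡⟨ cong (λ t → pow t d) (expand r) ⟩
    pow (r + r * r) d                 ∎
    where
    open ≤-Reasoning
    expand : ∀ r → r * (1ℚ + r) ≡ r + r * r
    expand = solve-∀ ring
    shift : ∀ M x → M + (1ℚ - x) ≡ M - x + 1ℚ
    shift = solve-∀ ring
    shift-1 : ∀ M x → M - 1ℚ + (1ℚ - x) ≡ M - x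
    shift-1 = solve-∀ ring
    cycle : PotentialStep (_+ r) d n
    cycle {M} _ 0≤y = subst₂ (λ s t → pow (M - A/P) d * pow s n ≤ pow M d * pow t n)
      (sym (shift M A/P)) (sym (shift-1 M A/P)) (cycle-under n e 0≤y weights)
    openShare-bound : pow openShare d * pow K n ≤ pow (1ℚ + r) d
    openShare-bound = begin
      pow openShare d * pow K n        ≤⟨ *-monoˡ-≤-nonNeg′ (pow-nonNeg d (<⇒≤ openShare-pos))
                                            (pow-monoˡ-≤ n (ℕ→ℚ-nonNeg (suc k′)) (p≤p+q 0≤r)) ⟩
      pow openShare d * pow (K + r) n  ≤⟨ descent-to-last (_+ r) d n cycle ⟩
      pow (1ℚ + r) n                   ≤⟨ pow-monoʳ-≤ (p≤p+q 0≤r) (ℕ.m≤m+n n e) ⟩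
      pow (1ℚ + r) d                   ∎

  overdelivery-pow-≤ : r < 0ℚ → ∀ d e {n} → d ℕ.+ e ≡ n → A/P * ℕ→ℚ d ≡ ℕ→ℚ n →
                       pow overdelivery d * pow K n ≤ pow ∣ r ∣ d
  overdelivery-pow-≤ r<0 d e {n} refl weights = begin
    pow overdelivery d * pow K n       ≡⟨ cong (λ t → pow t d * pow K n) overdelivery≡openShare*-r ⟩
    pow (openShare * - r) d * pow K n  ≤⟨ pow-*-≤ d 0≤-r openShare-bound ⟩
    pow (- r) d * 1ℚ                   ≡⟨ *-identityʳ (pow (- r) d) ⟩
    pow (- r) d                        ≡⟨ cong (λ t → pow t d) ∣r∣≡-r ⟨
    pow ∣ r ∣ d                        ∎
    where
    open ≤-Reasoning
    0≤-r = <⇒≤ (neg-antimono-< r<0)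
    ∣r∣≡-r : ∣ r ∣ ≡ - r
    ∣r∣≡-r = trans (sym (∣-p∣≡∣p∣ r)) (0≤p⇒∣p∣≡p 0≤-r)
    cycle : PotentialStep (λ M → M) d n
    cycle 0<M 0≤y = cycle-over d e 0≤y (<⇒≤ 0<M) weights
    openShare-bound : pow openShare d * pow K n ≤ 1ℚ
    openShare-bound =
      subst (pow openShare d * pow K n ≤_) (pow-1ℚ n) (descent-to-last (λ M → M) d n cycle)

  underdelivery-bounds : 0ℚ < r →
    (0ℚ < underdelivery) ×
    (∀ (n d : ℕ) → 1 ℕ.≤ d → A * ℕ→ℚ d ≡ P * ℕ→ℚ n →
       pow underdelivery d * pow K n ≤ pow (r + r * r) d)
  underdelivery-bounds 0<r = subst (0ℚ <_) (sym underdelivery≡openShare*r) (*-pos openShare-pos 0<r) ,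
    λ n d _ Ad≡Pn →
      let weights = A/P-from-weights n d Ad≡Pn
          n≤d = ratio≤1⇒≤ {A/P} n d (<⇒≤ (0<q-p⇒p<q {A/P} {1ℚ} 0<r)) weights
      in underdelivery-pow-≤ (<⇒≤ 0<r) n (d ∸ n) (ℕ.m+[n∸m]≡n n≤d) weights

  overdelivery-bounds : r < 0ℚ →
    (0ℚ < overdelivery) ×
    (∀ (n d : ℕ) → 1 ℕ.≤ d → A * ℕ→ℚ d ≡ P * ℕ→ℚ n →
       pow overdelivery d * pow K n ≤ pow ∣ r ∣ d)
  overdelivery-bounds r<0 = subst (0ℚ <_) (sym overdelivery≡openShare*-r) (*-pos openShare-pos 0<-r) ,
    λ n d _ Ad≡Pn →
      let weights = A/P-from-weights n d Ad≡Pn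
          d≤n = ratio≥1⇒≥ {A/P} n d (<⇒≤ (q-p<0⇒q<p {A/P} {1ℚ} r<0)) weights
      in overdelivery-pow-≤ r<0 d (n ∸ d) (ℕ.m+[n∸m]≡n d≤n) weights
    where
    0<-r = neg-antimono-< r<0

theorem1 : (k : ℕ) → 1 ℕ.≤ k → (D P A : ℚ) → 0ℚ < D → 0ℚ < P → 0ℚ < A →
           (∀ (j : ℕ) → j ℕ.< k → (0ℚ < rate k D P A j) × (rate k D P A j ≤ 1ℚ)) →
           -- (i) r > 0 : underdelivery U = D_{k+1}/D satisfies 0 < U ≤ (r + r²) / k^(1-r),
           -- where 1 - r = A/P = n/d, and  U ≤ c / k^(n/d)  is written as  U^d * k^n ≤ c^d
           (0ℚ < errRate P A →
             (0ℚ < remaining k D P A k * inv D) ×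
             (∀ (n d : ℕ) → 1 ℕ.≤ d → A * ℕ→ℚ d ≡ P * ℕ→ℚ n →
                pow (remaining k D P A k * inv D) d * pow (ℕ→ℚ k) n
                  ≤ pow (errRate P A + errRate P A * errRate P A) d)) ×
           -- (ii) r < 0 : overdelivery O = -D_{k+1}/D satisfies 0 < O ≤ |r| / k^(1-r)
           (errRate P A < 0ℚ →
             (0ℚ < - (remaining k D P A k * inv D)) ×
             (∀ (n d : ℕ) → 1 ℕ.≤ d → A * ℕ→ℚ d ≡ P * ℕ→ℚ n →
                pow (- (remaining k D P A k * inv D)) d * pow (ℕ→ℚ k) n
                  ≤ pow ∣ errRate P A ∣ d))
theorem1 (suc k′) _ D P A 0<D 0<P _ feasible = underdelivery-bounds , overdelivery-bounds
  where open Delivery k′ D P A 0<D 0<P (λ j j<k → proj₁ (feasible j j<k))
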